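{- Let $H=(\Sigma,V_H,E_H)$ and $Q=(\Sigma,V_Q,E_Q)$ be host graphs (host and query). Let $G$ be the guest $(\Sigma,V_Q,E_Q,\mathcal{M},\mathcal{U},\mathcal{X},\mathcal{C})$ with $\mathcal{M}=V_Q$, $\mathcal{U}=\mathcal{X}=\emptyset$ and $\mathcal{C}(v)=\{\mathrm{out}(v)\}$ for every $v\in V_Q$. Then there exists a graph simulation of $Q$ in $H$ if and only if $\mathrm{LGS}(G,H)\neq\emptyset$.
   Context: A host graph is a triple $(\Sigma,V,E)$ with $\Sigma$ a finite alphabet, $V$ a finite set of nodes and $E\subseteq V\times\Sigma\times V$. For $e=(v,l,v')$: $s(e)=v$, $\sigma(e)=l$, $t(e)=v'$; $\mathrm{out}(v)=\{e\mid s(e)=v\}$. A graph simulation of $Q=(\Sigma,V_Q,E_Q)$ in $H=(\Sigma,V_H,E_H)$ is a relation $R\subseteq V_Q\times V_H$ such that every $u\in V_Q$ has some $v\in V_H$ with $(u,v)\in R$, and for each $(u,v)\in R$ and each $e\in\mathrm{out}(u)$ there is $e'\in\mathrm{out}(v)$ with $\sigma(e)=\sigma(e')$ and $(t(e),t(e'))\in R$. A path is a finite nonempty sequence of edges $(e_0,\dots,e_n)$ with $s(e_i)=t(e_{i-1})$ for $1\le i\le n$, going from $s(e_0)$ to $t(e_n)$. A guest is $G=(\Sigma_G,V_G,E_G,\mathcal{M},\mathcal{U},\mathcal{X},\mathcal{C})$ where $(\Sigma_G,V_G,E_G)$ is a host graph, $\mathcal{M},\mathcal{U},\mathcal{X}\subseteq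 V_G$ (must, unique, exclusive sets) and $\mathcal{C}:V_G\to\mathcal{P}(\mathcal{P}(E_G))$ with $\bigcup\mathcal{C}(v)=\mathrm{out}(v)$. The tensor product $G\times H$ is $(\Sigma_G\cap\Sigma_H,V_G\times V_H,\{((u,u'),a,(v,v'))\mid (u,a,v)\in E_G,(u',a,v')\in E_H\})$. A loose graph simulation (LGS) of $G$ in $H$ is a subgraph $S=(\Sigma_G\cap\Sigma_H,V^{G\to H},E^{G\to H})$ of $G\times H$ such that: (1) for each $u\in\mathcal{M}$ there is $u'\in V_H$ with $(u,u')\in V^{G\to H}$; (2) for each $u\in\mathcal{U}$, if $(u,u'),(u,v')\in V^{G\to H}$ then $u'=v'$; (3) for each $u\in\mathcal{X}$, $v\in V_G$, $u'\in V_H$, if $(u,u'),(v,u')\in V^{G\to H}$ then $u=v$; (4) for each $(u,u')\in V^{G\to H}$ there is $\gamma\in\mathcal{C}(u)$ such that for all $(u,a,v)\in\gamma$, $((u,u'),a,(v,v'))\in E^{G\to H}$ for some $v'$; and for each $((u,u'),a,(v,v'))\in E^{G\to H}$ there is $\gamma\in\mathcal{C}(u)$ with $(u,a,v)\in\gamma$ such that for each $(u,b,w)\in\gamma$, $((u,u'),b,(w,w'))\in E^{G\to H}$ for some $w'$; (5) for each $(u,u')\in V^{G\to H}$ and $v\in\mathcal{M}$, if $G$ has a path from $u$ to $v$ then for some $v'\in V_H$, $S$ has a path from $(u,u')$ to $(v,v')$. $\mathrm{LGS}(G,H)$ denotes the set of all LGSs of $G$ in $H$. -}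

module Defs where

open import Data.Nat using (ℕ)
open import Data.Fin using (Fin)
open import Data.Bool using (Bool; true; _∧_)
open import Data.List using (List; [_])
open import Data.List.Relation.Unary.Any using (Any; here)
open import Data.Product using (_×_; _,_; ∃; proj₁; proj₂)
open import Relation.Binary.PropositionalEquality using (_≡_)
open import Function.Bundles using (_⇔_; mk⇔)
open import Data.Fin using (_≟_)
open import Relation.Nullary.Decidable using (⌊_⌋; yes; no; Dec)
open import Data.Empty using (⊥-elim)
open import Data.Bool using (false)

-- A host graph over the finite alphabet Σ = Fin k: finite node set Fin n,
-- edge set E ⊆ V × Σ × V given by its (decidable) characteristic function.
record HostGraph (k : ℕ) : Set where
  field
    n : ℕ
    E : Fin n → Fin k → Fin n → Bool
open HostGraph public

data Path {k : ℕ} {V : Set} (E : V → Fin k → V → Bool) : V → V → Set where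
  edge : ∀ {u a v} → E u a v ≡ true → Path E u v
  step : ∀ {u a w v} → E u a w ≡ true → Path E w v → Path E u v

record IsGraphSimulation {k : ℕ} (Q H : HostGraph k) (R : Fin (n Q) → Fin (n H) → Bool) : Set where
  field
    total : ∀ u → ∃ λ v → R u v ≡ true
    sim   : ∀ u v → R u v ≡ true → ∀ a w → E Q u a w ≡ true →
            ∃ λ w' → E H v a w' ≡ true × R w w' ≡ true

-- A guest over alphabet Σ = Fin k.  C(v) is a finite set (list) of sets of edges,
-- each set of edges given by its characteristic function; ⋃ C(v) = out(v).
record Guest (k : ℕ) : Set where
  field
    graph : HostGraph k
    M U X : Fin (n graph) → Bool
    C     : Fin (n graph) → List (Fin (n graph) → Fin k → Fin (n graph) → Bool)
    C-union : ∀ w u a v → Any (λ γ → γ u a v ≡ true) (C w) ⇔ (E graph u a v ≡ true × u ≡ w)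
open Guest public

-- Tensor product G × H (both over the same alphabet, so Σ_G ∩ Σ_H = Σ).
ProdNode : {k : ℕ} → Guest k → HostGraph k → Set
ProdNode G H = Fin (n (graph G)) × Fin (n H)

tensorE : {k : ℕ} (G : Guest k) (H : HostGraph k) →
          ProdNode G H → Fin k → ProdNode G H → Bool
tensorE G H (u , u') a (v , v') = E (graph G) u a v ∧ E H u' a v'

record Subgraph {k : ℕ} (G : Guest k) (H : HostGraph k) : Set where
  field
    VS : ProdNode G H → Bool
    ES : ProdNode G H → Fin k → ProdNode G H → Bool
    ES⊆ : ∀ p a q → ES p a q ≡ true → tensorE G H p a q ≡ true
    ES-src : ∀ p a q → ES p a q ≡ true → VS p ≡ true
    ES-tgt : ∀ p a q → ES p a q ≡ true → VS q ≡ true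
open Subgraph public

record IsLGS {k : ℕ} (G : Guest k) (H : HostGraph k) (S : Subgraph G H) : Set where
  field
    must      : ∀ u → M G u ≡ true → ∃ λ u' → VS S (u , u') ≡ true
    unique    : ∀ u → U G u ≡ true → ∀ u' v' →
                VS S (u , u') ≡ true → VS S (u , v') ≡ true → u' ≡ v'
    exclusive : ∀ u → X G u ≡ true → ∀ v u' →
                VS S (u , u') ≡ true → VS S (v , u') ≡ true → u ≡ v
    choice-node : ∀ u u' → VS S (u , u') ≡ true →
                  Any (λ γ → ∀ a v → γ u a v ≡ true →
                         ∃ λ v' → ES S (u , u') a (v , v') ≡ true) (C G u)
    choice-edge : ∀ u u' a v v' → ES S (u , u') a (v , v') ≡ true →
                  Any (λ γ → γ u a v ≡ true ×
                         (∀ b w → γ u b w ≡ true →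
                            ∃ λ w' → ES S (u , u') b (w , w') ≡ true)) (C G u)
    reach     : ∀ u u' → VS S (u , u') ≡ true → ∀ v → M G v ≡ true →
                Path (E (graph G)) u v →
                ∃ λ v' → Path (ES S) (u , u') (v , v')

out : {k : ℕ} (Q : HostGraph k) → Fin (n Q) → Fin (n Q) → Fin k → Fin (n Q) → Bool
out Q w u a v = ⌊ u ≟ w ⌋ ∧ E Q u a v

queryGuest : {k : ℕ} → HostGraph k → Guest k
queryGuest Q = record
  { graph = Q
  ; M = λ _ → true
  ; U = λ _ → false
  ; X = λ _ → false
  ; C = λ w → [ out Q w ]
  ; C-union = union
  }
  where
  union : ∀ w u a v → Any (λ γ → γ u a v ≡ true) [ out Q w ] ⇔ (E Q u a v ≡ true × u ≡ w)
  union w u a v = mk⇔ to from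
    where
    to : Any (λ γ → γ u a v ≡ true) [ out Q w ] → E Q u a v ≡ true × u ≡ w
    to (here p) with u ≟ w
    ... | yes eq = p , eq
    to (here ()) | no _
    from : E Q u a v ≡ true × u ≡ w → Any (λ γ → γ u a v ≡ true) [ out Q w ]
    from (p , eq) = here (lem (u ≟ w))
      where
      lem : (d : Dec (u ≡ w)) → ⌊ d ⌋ ∧ E Q u a v ≡ true
      lem (yes _) = p
      lem (no ne) = ⊥-elim (ne eq)

module Submission where

-- (⇒) A graph simulation R of Q in H determines the subgraph of Q × H
--     induced on R: nodes are the pairs in R, edges are the product edges
--     between such pairs.  The simulation property lets every edge, and by
--     induction every path, of Q be lifted into this subgraph from any
--     related pair; this gives the choice conditions (4) and the
--     reachability condition (5), while (1) is totality of R and (2), (3)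
--     are vacuous.
-- (⇐) Conversely the node set of an LGS is a graph simulation: totality is
--     the must condition (1), and the simulation step is the node choice
--     condition (4) for the only choice set out(u).

open import Defs
open import Data.Nat using (ℕ)
open import Data.Bool using (Bool; true; _∧_)
open import Data.Bool.Properties using (∧-conicalˡ; ∧-conicalʳ)
open import Data.Fin using (Fin; _≟_)
open import Data.List.Relation.Unary.Any using (Any; here)
open import Data.Product using (∃; _×_; _,_; proj₁; proj₂)
open import Function.Bundles using (_⇔_; mk⇔)
open import Relation.Binary.PropositionalEquality using (_≡_; refl; sym; trans)
open import Relation.Nullary using (yes; no; contradiction)

∧-intro : ∀ {a b : Bool} → a ≡ true → b ≡ true → a ∧ b ≡ true
∧-intro refl refl = refl

∧-elim : ∀ {a b : Bool} → a ∧ b ≡ true → a ≡ true × b ≡ true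
∧-elim {a} {b} p = ∧-conicalˡ a b p , ∧-conicalʳ a b p

out-diagonal : ∀ {k} (Q : HostGraph k) u a v → out Q u u a v ≡ E Q u a v
out-diagonal Q u a v with u ≟ u
... | yes _   = refl
... | no u≢u = contradiction refl u≢u

inducedE : ∀ {k} (G : Guest k) (H : HostGraph k) (R : Fin (n (graph G)) → Fin (n H) → Bool) →
           ProdNode G H → Fin k → ProdNode G H → Bool
inducedE G H R (u , u') a (v , v') = (R u u' ∧ R v v') ∧ tensorE G H (u , u') a (v , v')

inducedE-elim : ∀ {k} (G : Guest k) (H : HostGraph k) R {u u' a v v'} →
                inducedE G H R (u , u') a (v , v') ≡ true →
                (R u u' ≡ true × R v v' ≡ true) × tensorE G H (u , u') a (v , v') ≡ true
inducedE-elim G H R {u} {u'} {a} {v} {v'} e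
  with ends , product ← ∧-elim {R u u' ∧ R v v'} e = ∧-elim ends , product

induced : ∀ {k} (G : Guest k) (H : HostGraph k) →
          (Fin (n (graph G)) → Fin (n H) → Bool) → Subgraph G H
induced G H R = record
  { VS     = λ { (u , u') → R u u' }
  ; ES     = inducedE G H R
  ; ES⊆    = λ { (u , u') a (v , v') e → proj₂ (inducedE-elim G H R e) }
  ; ES-src = λ { (u , u') a (v , v') e → proj₁ (proj₁ (inducedE-elim G H R e)) }
  ; ES-tgt = λ { (u , u') a (v , v') e → proj₂ (proj₁ (inducedE-elim G H R e)) }
  }

module Lifting {k} (G : Guest k) (H : HostGraph k) (R : Fin (n (graph G)) → Fin (n H) → Bool)
               (isSim : IsGraphSimulation (graph G) H R) where
  open IsGraphSimulation isSim using (sim)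

  lift-edge : ∀ {u u' a v} → R u u' ≡ true → E (graph G) u a v ≡ true →
              ∃ λ v' → inducedE G H R (u , u') a (v , v') ≡ true × R v v' ≡ true
  lift-edge {u} {u'} {a} {v} r e with v' , e' , r' ← sim u u' r a v e =
    v' , ∧-intro (∧-intro r r') (∧-intro e e') , r'

  lift-path : ∀ {u u' v} → R u u' ≡ true → Path (E (graph G)) u v →
              ∃ λ v' → Path (inducedE G H R) (u , u') (v , v')
  lift-path r (edge e) with v' , e' , _ ← lift-edge r e = v' , edge e'
  lift-path r (step e p) with w' , e' , r' ← lift-edge r e
                         with v' , p' ← lift-path r' p = v' , step e' p'

simulation⇒LGS : ∀ {k} (Q H : HostGraph k) (R : Fin (n Q) → Fin (n H) → Bool) →
                 IsGraphSimulation Q H R → IsLGS (queryGuest Q) H (induced (queryGuest Q) H R)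
simulation⇒LGS {k} Q H R isSim = record
  { must        = λ u _ → total u
  ; unique      = λ _ ()
  ; exclusive   = λ _ ()
  ; choice-node = λ u u' r → here (lift-out r)
  ; choice-edge = λ u u' a v v' e →
      let (r , _) , product = inducedE-elim G H R e in
      here (trans (out-diagonal Q u a v) (proj₁ (∧-elim product)) , lift-out r)
  ; reach       = λ u u' r v _ p → lift-path r p
  }
  where
  G : Guest k
  G = queryGuest Q
  open IsGraphSimulation isSim using (total)
  open Lifting G H R isSim

  lift-out : ∀ {u u'} → R u u' ≡ true → ∀ a v → out Q u u a v ≡ true →
             ∃ λ v' → inducedE G H R (u , u') a (v , v') ≡ true
  lift-out r a v o with v' , e' , _ ← lift-edge r (trans (sym (out-diagonal Q _ a v)) o) = v' , e'

LGS⇒simulation : ∀ {k} (Q H : HostGraph k) (S : Subgraph (queryGuest Q) H) →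
                 IsLGS (queryGuest Q) H S → IsGraphSimulation Q H (λ u u' → VS S (u , u'))
LGS⇒simulation Q H S isLGS = record
  { total = λ u → must u refl
  ; sim   = λ u u' r a v e → chosen-image u u' a v e (choice-node u u' r)
  }
  where
  open IsLGS isLGS using (must; choice-node)

  -- The only choice set is out(u), so each edge of Q from u has a chosen image edge.
  chosen-image : ∀ u u' a v → E Q u a v ≡ true →
                 Any (λ γ → ∀ a v → γ u a v ≡ true → ∃ λ v' → ES S (u , u') a (v , v') ≡ true)
                     (C (queryGuest Q) u) →
                 ∃ λ v' → E H u' a v' ≡ true × VS S (v , v') ≡ true
  chosen-image u u' a v e (here chosen) with v' , s ← chosen a v (trans (out-diagonal Q u a v) e) =
    v' , proj₂ (∧-elim (ES⊆ S (u , u') a (v , v') s)) , ES-tgt S (u , u') a (v , v') s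

proposition6 : (k : ℕ) (H Q : HostGraph k) →
    (∃ λ R → IsGraphSimulation Q H R) ⇔ (∃ λ S → IsLGS (queryGuest Q) H S)
proposition6 k H Q = mk⇔
  (λ { (R , isSim) → induced (queryGuest Q) H R , simulation⇒LGS Q H R isSim })
  (λ { (S , isLGS) → (λ u u' → VS S (u , u')) , LGS⇒simulation Q H S isLGS })
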